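{- Let $m,l\ge1$, $\sigma\in S_m$, $\alpha\in S_l$, and suppose there are integers $i_1<\dots<i_s<a$ with $a+1\le m$ and an integer $b$ such that $\operatorname{RLmax}\sigma=\{i_1,\dots,i_s,a\}\cup[a+1,m]$ and $\operatorname{RLmax}\alpha=[b-a,l]$. Let $\sigma'=\sigma(\alpha,a+1)$. Assume $\operatorname{Stp}\alpha=\emptyset$ and $\operatorname{Stp}\sigma\subseteq\{a\}$. If $\alpha_1<l$, then $\operatorname{Stp}\sigma'=\emptyset$.
   Context: $[x,y]=\{x,\dots,y\}$. $\operatorname{Stp}\pi=\{i:\pi_i-1=\pi_{i+1}\}$ (steps). $\operatorname{RLmax}\pi$ is the set of indices $i$ with $\pi_i>\pi_j$ for all $j>i$. Inflation: for $\sigma\in S_m$, $\alpha\in S_l$ and $1\le a+1\le m$, $\sigma(\alpha,a+1)$ is the permutation of length $l+m-1$ given by $\hat\sigma_1\ldots\hat\sigma_a\,\hat\alpha_1\ldots\hat\alpha_l\,\hat\sigma_{a+2}\ldots\hat\sigma_m$, where $\hat\alpha_i=\alpha_i+\sigma_{a+1}-1$, and $\hat\sigma_i=\sigma_i$ if $\sigma_i<\sigma_{a+1}$, $\hat\sigma_i=\sigma_i+l-1$ otherwise. -}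

module Defs where

open import Data.Nat using (ℕ; zero; suc; _+_; _∸_; _≤_; _<_; _<ᵇ_)
open import Data.Bool using (if_then_else_)
open import Data.List using (List; []; _∷_; map; take; drop; length; upTo; _++_)
open import Data.List.Relation.Binary.Permutation.Propositional using (_↭_)
open import Data.Product using (_×_)
open import Relation.Binary.PropositionalEquality using (_≡_)

-- A permutation of length m is represented in one-line notation as the list
-- π₁ … π_m (values in {1,…,m}); positions are 1-based.

-- 1-based lookup (returns 0 outside [1, length]).
at : List ℕ → ℕ → ℕ
at []       _             = 0
at (x ∷ xs) zero          = 0
at (x ∷ xs) (suc zero)    = x
at (x ∷ xs) (suc (suc i)) = at xs (suc i)

IsPerm : ℕ → List ℕ → Set
IsPerm m π = π ↭ map suc (upTo m)

Stp : List ℕ → ℕ → Set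
Stp π i = 1 ≤ i × suc i ≤ length π × at π i ∸ 1 ≡ at π (suc i)

RLmax : List ℕ → ℕ → Set
RLmax π i = 1 ≤ i × i ≤ length π
          × (∀ j → i < j → j ≤ length π → at π j < at π i)

-- Inflation σ(α, a+1), for σ ∈ S_m, α ∈ S_l (l = length α).
inflate : List ℕ → List ℕ → ℕ → List ℕ
inflate σ α a =
  map hat (take a σ) ++ map (λ x → x + p ∸ 1) α ++ map hat (drop (suc a) σ)
  where
  p : ℕ
  p = at σ (suc a)
  hat : ℕ → ℕ
  hat x = if x <ᵇ p then x else x + length α ∸ 1

-- A step of the inflation σ(α, a+1) lies inside one of its three blocks or at one of the two
-- junctions. Inside a block there is none: the blocks are images of step-free lists (σ before
-- position a, α, σ after position a+1) under strictly increasing maps, and such maps reflect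
-- steps. At the first junction σ_a > σ_{a+1} lifts σ̂_a so high that α₁ < l gives
-- α̂₁ < σ̂_a − 1. At the second, σ_{a+1} > σ_{a+2}, so a step from α̂_l down to σ̂_{a+2} = σ_{a+2}
-- forces α_l = 1 and σ_{a+1} − 1 = σ_{a+2}, a step of σ at a+1.
module Submission where

open import Defs
open import Data.Bool using (true; false; if_then_else_)
open import Data.Empty using (⊥)
open import Data.Integer using (ℤ; +_; _-_) renaming (_≤_ to _≤ℤ_)
open import Data.List using (List; []; _∷_; _++_; map; take; drop; length; upTo; head; last)
open import Data.List.Membership.Propositional using (_∈_)
open import Data.List.Membership.Propositional.Properties using (∈-map⁻)
open import Data.List.Properties using (length-map; length-upTo; head-map; last-map; take-all; drop-all)
open import Data.List.Relation.Binary.Permutation.Propositional.Properties using (↭-length; ∈-resp-↭)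
open import Data.List.Relation.Unary.All using (All)
open import Data.List.Relation.Unary.Any using (here; there)
open import Data.List.Relation.Unary.Linked using (Linked; []; [-]; _∷_)
import Data.List.Relation.Unary.Linked as Linked
open import Data.List.Relation.Unary.Linked.Properties using (map⁺; ++⁺)
open import Data.Maybe using (just; nothing)
import Data.Maybe as Maybe
open import Data.Maybe.Relation.Binary.Connected using (Connected; just; just-nothing; nothing)
open import Data.Nat using (ℕ; zero; suc; _+_; _∸_; _≤_; _<_; _<ᵇ_; z≤n; s≤s; s≤s⁻¹; z<s; _≤?_; _<?_)
open import Data.Nat.Properties
open import Data.Product using (_×_; _,_; proj₁)
open import Data.Sum using (_⊎_; inj₁; inj₂)
open import Function using (_∘_)
open import Function.Bundles using (_⇔_; module Equivalence)
open import Relation.Binary.Core using (_Preserves_⟶_)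
open import Relation.Binary.Definitions using (tri<; tri≈; tri>)
open import Relation.Binary.PropositionalEquality using (_≡_; refl; sym; trans; cong; subst)
open import Relation.Nullary using (¬_; yes; no; contradiction)

IsStep : ℕ → ℕ → Set
IsStep x y = x ∸ 1 ≡ y

NonStep : ℕ → ℕ → Set
NonStep x y = ¬ IsStep x y

StepFree : List ℕ → Set
StepFree = Linked NonStep

Stp-∷ : ∀ {x xs i} → Stp xs i → Stp (x ∷ xs) (suc i)
Stp-∷ {i = suc i} (_ , i<len , step) = s≤s z≤n , s≤s i<len , step

Stp-∷⁻ : ∀ {x xs i} → Stp (x ∷ xs) (suc (suc i)) → Stp xs (suc i)
Stp-∷⁻ (_ , i<len , step) = s≤s z≤n , s≤s⁻¹ i<len , step

stepFree⇒¬Stp : ∀ {π} → StepFree π → ∀ i → ¬ Stp π i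
stepFree⇒¬Stp         []       i             (_ , () , _)
stepFree⇒¬Stp         [-]      zero          (() , _)
stepFree⇒¬Stp         [-]      (suc i)       (_ , s≤s () , _)
stepFree⇒¬Stp         (_ ∷ _)  zero          (() , _)
stepFree⇒¬Stp         (r ∷ _)  (suc zero)    (_ , _ , step) = r step
stepFree⇒¬Stp {x ∷ _} (_ ∷ rs) (suc (suc i)) s              = stepFree⇒¬Stp rs (suc i) (Stp-∷⁻ {x} s)

¬Stp⇒stepFree : ∀ π → (∀ i → ¬ Stp π i) → StepFree π
¬Stp⇒stepFree []           _ = []
¬Stp⇒stepFree (x ∷ [])     _ = [-]
¬Stp⇒stepFree (x ∷ y ∷ ys) h =
  (λ step → h 1 (s≤s z≤n , s≤s (s≤s z≤n) , step)) ∷ ¬Stp⇒stepFree (y ∷ ys) (λ i → h (suc i) ∘ Stp-∷ {x})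

stepFree-drop : ∀ n π → (∀ i → Stp π i → i ≤ n) → StepFree (drop n π)
stepFree-drop zero    π        h = ¬Stp⇒stepFree π (λ i s → <⇒≱ (proj₁ s) (h i s))
stepFree-drop (suc n) []       h = []
stepFree-drop (suc n) (x ∷ xs) h = stepFree-drop n xs (λ i → s≤s⁻¹ ∘ h (suc i) ∘ Stp-∷)

stepFree-take : ∀ n π → (∀ i → Stp π i → n ≤ i) → StepFree (take n π)
stepFree-take zero          π            h = []
stepFree-take (suc n)       []           h = []
stepFree-take (suc zero)    (x ∷ xs)     h = [-]
stepFree-take (suc (suc n)) (x ∷ [])     h = [-]
stepFree-take (suc (suc n)) (x ∷ y ∷ ys) h =
  (λ step → contradiction (h 1 (s≤s z≤n , s≤s (s≤s z≤n) , step)) λ { (s≤s ()) })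
  ∷ stepFree-take (suc n) (y ∷ ys) (λ i → s≤s⁻¹ ∘ h (suc i) ∘ Stp-∷)

increasing⇒reflects-IsStep : ∀ {f} → f Preserves _<_ ⟶ _<_ → ∀ {x y} → IsStep (f x) (f y) → IsStep x y
increasing⇒reflects-IsStep     f↑ {zero}  {zero}  _    = refl
increasing⇒reflects-IsStep {f} f↑ {zero}  {suc y} step =
  contradiction step (<⇒≢ (≤-<-trans (m∸n≤m (f 0) 1) (f↑ z<s)))
increasing⇒reflects-IsStep {f} f↑ {suc x} {y}     step with <-cmp (suc x) y
... | tri< x+1<y _ _ = contradiction step (<⇒≢ (≤-<-trans (m∸n≤m (f (suc x)) 1) (f↑ x+1<y)))
... | tri≈ _ refl _  = contradiction step (<⇒≢ (∸1< (f↑ (z<s {x}))))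
  where
  ∸1< : ∀ {m n} → m < n → n ∸ 1 < n
  ∸1< {n = suc n} _ = n<1+n n
... | tri> _ _ y<x+1 with m≤n⇒m<n∨m≡n (s≤s⁻¹ y<x+1)
...   | inj₂ refl = refl
...   | inj₁ y<x  = contradiction (sym step)
  (<⇒≢ (∸-monoˡ-< (<-≤-trans (s≤s (f↑ y<x)) (f↑ (n<1+n x))) (s≤s z≤n)))

stepFree-map : ∀ {f xs} → f Preserves _<_ ⟶ _<_ → StepFree xs → StepFree (map f xs)
stepFree-map f↑ = map⁺ ∘ Linked.map (λ nonStep → nonStep ∘ increasing⇒reflects-IsStep f↑)

-- In σ(α, a+1) the entries of α are mapped by shift σ_{a+1} and the other entries of σ by
-- hat σ_{a+1} l, the paper's x ↦ x̂.
shift : ℕ → ℕ → ℕ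
shift p x = x + p ∸ 1

hat : ℕ → ℕ → ℕ → ℕ
hat p l x = if x <ᵇ p then x else shift l x

shift-increasing : ∀ {p} → 1 ≤ p → shift p Preserves _<_ ⟶ _<_
shift-increasing {p} p≥1 {x} x<y = ∸-monoˡ-< (+-monoˡ-< p x<y) (≤-trans p≥1 (m≤n+m p x))

n≤shift : ∀ {l} → 1 ≤ l → ∀ x → x ≤ shift l x
n≤shift l≥1 x = subst (x ≤_) (sym (+-∸-assoc x l≥1)) (m≤m+n x _)

hat-below : ∀ {p l x} → x < p → hat p l x ≡ x
hat-below {p} {l} {x} x<p with x <ᵇ p | <⇒<ᵇ x<p
... | true | _ = refl

hat-above : ∀ {p l x} → p ≤ x → hat p l x ≡ shift l x
hat-above {p} {l} {x} p≤x with x <ᵇ p | <ᵇ⇒< x p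
... | true  | x<p = contradiction (x<p _) (≤⇒≯ p≤x)
... | false | _   = refl

hat-increasing : ∀ {p l} → 1 ≤ l → hat p l Preserves _<_ ⟶ _<_
hat-increasing {p} {l} l≥1 {x} {y} x<y with x <? p | y <? p
... | yes x<p | yes y<p
  rewrite hat-below {l = l} x<p | hat-below {l = l} y<p = x<y
... | yes x<p | no y≮p
  rewrite hat-below {l = l} x<p | hat-above {l = l} (≮⇒≥ y≮p) = <-≤-trans x<y (n≤shift l≥1 y)
... | no x≮p  | _
  rewrite hat-above {l = l} (≮⇒≥ x≮p) | hat-above {l = l} (≤-trans (≮⇒≥ x≮p) (<⇒≤ x<y))
  = shift-increasing l≥1 x<y

hat-shift-gap : ∀ {p s l y} → 1 ≤ p → p < s → y < l → NonStep (hat p l s) (shift p y)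
hat-shift-gap {p} {s} {l} {y} p≥1 p<s y<l rewrite hat-above {l = l} (<⇒≤ p<s) =
  λ step → <⇒≢ gap (sym step)
  where
  open ≤-Reasoning
  gap : shift p y < shift l s ∸ 1
  gap = begin-strict
    shift p y     <⟨ shift-increasing p≥1 y<l ⟩
    l + p ∸ 1     ≡⟨ cong (_∸ 1) (+-comm l p) ⟩
    p + l ∸ 1     ≤⟨ ∸-monoˡ-≤ 1 (∸-monoˡ-≤ 1 (+-monoˡ-≤ l p<s)) ⟩
    shift l s ∸ 1 ∎

-- Since shift p z ≥ p, a step down to a value below p must be the step from p itself.
shift-hat-step⇒step : ∀ {p l z w} → 1 ≤ z → w < p → IsStep (shift p z) (hat p l w) → IsStep p w
shift-hat-step⇒step {suc p} {l} {z} z≥1 w<p rewrite hat-below {l = l} w<p = λ step →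
  ≤-antisym (subst (p ≤_) step (∸-monoˡ-≤ 1 (∸-monoˡ-≤ 1 (+-monoˡ-≤ (suc p) z≥1)))) (s≤s⁻¹ w<p)

connected-just : ∀ {A : Set} {R : A → A → Set} {mx my x y} →
                 mx ≡ just x → my ≡ just y → R x y → Connected R mx my
connected-just refl refl r = just r

connected-nothingʳ : ∀ {A : Set} {R : A → A → Set} {mx my} → my ≡ nothing → Connected R mx my
connected-nothingʳ {mx = just _}  refl = just-nothing
connected-nothingʳ {mx = nothing} refl = nothing

at-∈ : ∀ xs {i} → 1 ≤ i → i ≤ length xs → at xs i ∈ xs
at-∈ (x ∷ xs) {suc zero}    _ _            = here refl
at-∈ (x ∷ xs) {suc (suc i)} _ (s≤s i<len) = there (at-∈ xs (s≤s z≤n) i<len)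

last-take : ∀ n xs → 1 ≤ n → n ≤ length xs → last (take n xs) ≡ just (at xs n)
last-take (suc zero)    (x ∷ xs)     _ _           = refl
last-take (suc (suc n)) (x ∷ [])     _ (s≤s ())
last-take (suc (suc n)) (x ∷ y ∷ ys) _ (s≤s n<len) = last-take (suc n) (y ∷ ys) (s≤s z≤n) n<len

head-drop : ∀ n xs → suc n ≤ length xs → head (drop n xs) ≡ just (at xs (suc n))
head-drop zero    (x ∷ xs) _           = refl
head-drop (suc n) (x ∷ xs) (s≤s n<len) = head-drop n xs n<len

last-at : ∀ xs → 1 ≤ length xs → last xs ≡ just (at xs (length xs))
last-at xs nonempty = trans (cong last (sym (take-all _ xs ≤-refl))) (last-take _ xs nonempty ≤-refl)

head-++ˡ : ∀ {xs ys : List ℕ} {x} → head xs ≡ just x → head (xs ++ ys) ≡ just x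
head-++ˡ {_ ∷ _} refl = refl

inflate-stepFree : ∀ σ α a → let p = at σ (suc a); L = length α in
  1 ≤ a → suc a ≤ length σ → 1 ≤ p → 1 ≤ L →
  StepFree (take a σ) → StepFree α → StepFree (drop (suc a) σ) →
  NonStep (hat p L (at σ a)) (shift p (at α 1)) →
  (suc (suc a) ≤ length σ → NonStep (shift p (at α L)) (hat p L (at σ (suc (suc a))))) →
  StepFree (inflate σ α a)
inflate-stepFree σ α a a≥1 a<len p≥1 L≥1 T-free α-free D-free gap₁ gap₂ =
  ++⁺ (stepFree-map (hat-increasing {p} L≥1) T-free) junction₁
      (++⁺ (stepFree-map (shift-increasing p≥1) α-free) junction₂
           (stepFree-map (hat-increasing {p} L≥1) D-free))
  where
  p L : ℕ
  p = at σ (suc a)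
  L = length α
  T D : List ℕ
  T = take a σ
  D = drop (suc a) σ

  junction₁ : Connected NonStep (last (map (hat p L) T)) (head (map (shift p) α ++ map (hat p L) D))
  junction₁ = connected-just
    (trans (last-map (hat p L) T) (cong (Maybe.map (hat p L)) (last-take a σ a≥1 (<⇒≤ a<len))))
    (head-++ˡ (trans (head-map α) (cong (Maybe.map (shift p)) (head-drop 0 α L≥1))))
    gap₁

  junction₂ : Connected NonStep (last (map (shift p) α)) (head (map (hat p L) D))
  junction₂ with suc (suc a) ≤? length σ
  ... | yes a+1<len = connected-just
    (trans (last-map (shift p) α) (cong (Maybe.map (shift p)) (last-at α L≥1)))
    (trans (head-map D) (cong (Maybe.map (hat p L)) (head-drop (suc a) σ a+1<len)))
    (gap₂ a+1<len)
  ... | no a+1≮len = connected-nothingʳ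
    (trans (head-map D) (cong (Maybe.map (hat p L) ∘ head) (drop-all (suc a) σ (s≤s⁻¹ (≰⇒> a+1≮len)))))

IsPerm-length : ∀ {m π} → IsPerm m π → length π ≡ m
IsPerm-length {m} π↭ = trans (↭-length π↭) (trans (length-map suc (upTo m)) (length-upTo m))

IsPerm-positive : ∀ {m π x} → IsPerm m π → x ∈ π → 1 ≤ x
IsPerm-positive π↭ x∈π with ∈-map⁻ suc (∈-resp-↭ π↭ x∈π)
... | _ , _ , refl = s≤s z≤n

RLmax-descent : ∀ {π i} → RLmax π i → suc i ≤ length π → at π (suc i) < at π i
RLmax-descent (_ , _ , dominates) = dominates _ ≤-refl

lemma7 : (m l : ℕ) → 1 ≤ m → 1 ≤ l
    → (σ α : List ℕ) → IsPerm m σ → IsPerm l α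
    → (is : List ℕ) (a : ℕ) (b : ℤ)
    → Linked _<_ is → All (_< a) is → suc a ≤ m
    → (∀ i → RLmax σ i ⇔ ((i ∈ is ⊎ i ≡ a) ⊎ (suc a ≤ i × i ≤ m)))
    → (∀ i → RLmax α i ⇔ ((b - + a ≤ℤ + i) × i ≤ l))
    → (∀ i → Stp α i → ⊥)
    → (∀ i → Stp σ i → i ≡ a)
    → at α 1 < l
    → ∀ i → Stp (inflate σ α a) i → ⊥
lemma7 m l _ l≥1 σ α σ-perm α-perm _ a _ _ _ a<m σ-RLmax _ α-noStep σ-steps α₁<l =
  stepFree⇒¬Stp (inflate-stepFree σ α a (proj₁ a-RLmax) a<len p≥1 L≥1 before α-free after gap₁ gap₂)
  where
  p : ℕ
  p = at σ (suc a)
  a<len : suc a ≤ length σ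
  a<len = subst (suc a ≤_) (sym (IsPerm-length σ-perm)) a<m
  L≥1 : 1 ≤ length α
  L≥1 = subst (1 ≤_) (sym (IsPerm-length α-perm)) l≥1
  p≥1 : 1 ≤ p
  p≥1 = IsPerm-positive σ-perm (at-∈ σ (s≤s z≤n) a<len)
  a-RLmax : RLmax σ a
  a-RLmax = Equivalence.from (σ-RLmax a) (inj₁ (inj₂ refl))
  a+1-RLmax : RLmax σ (suc a)
  a+1-RLmax = Equivalence.from (σ-RLmax (suc a)) (inj₂ (≤-refl , a<m))

  before : StepFree (take a σ)
  before = stepFree-take a σ (λ i → ≤-reflexive ∘ sym ∘ σ-steps i)
  α-free : StepFree α
  α-free = ¬Stp⇒stepFree α α-noStep
  after : StepFree (drop (suc a) σ)
  after = stepFree-drop (suc a) σ (λ i → m≤n⇒m≤1+n ∘ ≤-reflexive ∘ σ-steps i)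

  gap₁ : NonStep (hat p (length α) (at σ a)) (shift p (at α 1))
  gap₁ = hat-shift-gap p≥1 (RLmax-descent {σ} a-RLmax a<len)
           (subst (at α 1 <_) (sym (IsPerm-length α-perm)) α₁<l)
  gap₂ : suc (suc a) ≤ length σ → NonStep (shift p (at α (length α))) (hat p (length α) (at σ (suc (suc a))))
  gap₂ a+1<len step = 1+n≢n (σ-steps (suc a) (s≤s z≤n , a+1<len ,
    shift-hat-step⇒step (IsPerm-positive α-perm (at-∈ α L≥1 ≤-refl)) (RLmax-descent {σ} a+1-RLmax a+1<len) step))
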